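{- Let $(G,k,i,j)$ be an instance of Biclique-Free Vertex Deletion with $2\le i\le j$, and let $(v_1,v_2,v_3,v_4,v_5)$ be a path on five vertices in $G$ with $\deg(v_2)=\deg(v_3)=\deg(v_4)=2$. Then $(G,k,i,j)$ is a yes-instance if and only if $(G-v_3,k,i,j)$ is a yes-instance.
   Context: Biclique-Free Vertex Deletion: given an undirected graph $G$ and integers $i,j,k$ with $i\le j$, decide whether there is a set $V'\subseteq V(G)$ with $|V'|\le k$ such that $G-V'$ contains no $K_{i,j}$ as a (not necessarily induced) subgraph. -}

module Defs where

open import Data.Nat using (ℕ; suc; _≤_)
open import Data.Bool using (Bool; true; false)
open import Data.Fin using (Fin; punchIn)
open import Data.Fin.Subset using (Subset; ∣_∣; _∉_)
open import Data.Vec using (tabulate)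
open import Data.Product using (Σ; _×_; ∃)
open import Function.Definitions using (Injective)
open import Relation.Nullary using (¬_)
open import Relation.Binary.PropositionalEquality using (_≡_; _≢_)

record Graph (n : ℕ) : Set where
  field
    adj    : Fin n → Fin n → Bool
    sym    : ∀ u v → adj u v ≡ adj v u
    irrefl : ∀ v → adj v v ≡ false
open Graph public

Adj : ∀ {n} → Graph n → Fin n → Fin n → Set
Adj G u v = adj G u v ≡ true

degree : ∀ {n} → Graph n → Fin n → ℕ
degree G v = ∣ tabulate (adj G v) ∣

deleteVertex : ∀ {n} → Graph (suc n) → Fin (suc n) → Graph n
deleteVertex G x = record
  { adj    = λ u v → adj G (punchIn x u) (punchIn x v)
  ; sym    = λ u v → sym G (punchIn x u) (punchIn x v)
  ; irrefl = λ v → irrefl G (punchIn x v)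
  }

-- G - S contains K_{i,j} as a (not necessarily induced) subgraph:
-- i distinct vertices and j distinct vertices, the two sides disjoint,
-- all outside S, every vertex of the first side adjacent to every vertex of the second.
ContainsBicliqueAvoiding : ∀ {n} → Graph n → Subset n → ℕ → ℕ → Set
ContainsBicliqueAvoiding {n} G S i j =
  Σ (Fin i → Fin n) λ f → Σ (Fin j → Fin n) λ g →
    Injective _≡_ _≡_ f × Injective _≡_ _≡_ g ×
    (∀ a b → f a ≢ g b) ×
    (∀ a → f a ∉ S) × (∀ b → g b ∉ S) ×
    (∀ a b → Adj G (f a) (g b))

YesInstance : ∀ {n} → Graph n → ℕ → ℕ → ℕ → Set
YesInstance G k i j =
  ∃ λ S → ∣ S ∣ ≤ k × ¬ ContainsBicliqueAvoiding G S i j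

-- Neither side of a K_{i,j} with 2 ≤ i ≤ j is a single vertex, so every vertex x of such a
-- biclique has two distinct neighbours with a further common neighbour, i.e. x lies on a
-- 4-cycle. The middle vertex v₃ of the path does not: its neighbours are v₂ and v₄, whose
-- only other neighbours are v₁ and v₅ respectively. Hence no biclique ever uses v₃, and a
-- solution for G - v₃ lifts to one for G by adding v₃ outside the deletion set; the other
-- direction holds for every vertex.
module Submission where

open import Defs
open import Data.Nat using (ℕ; suc; _≤_; z≤n; s≤s)
open import Data.Nat.Properties using (≤-trans; ≤-refl; m≤n⇒m≤1+n; <⇒≱)
open import Data.Fin using (Fin; zero; suc; punchIn; punchOut; _≟_)
open import Data.Fin.Properties using (punchIn-injective; punchIn-punchOut)
open import Data.Fin.Subset using (Subset; ∣_∣; _∈_; _-_; inside; outside)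
open import Data.Fin.Subset.Properties using (x∈p∧x≢y⇒x∈p-y; x∈p⇒∣p-x∣<∣p∣)
open import Data.Vec using (Vec; _∷_; tabulate; lookup; insertAt; removeAt)
open import Data.Vec.Properties using (lookup∘tabulate; lookup⇒[]=; []=⇒lookup; insertAt-punchIn)
open import Data.Product using (_×_; _,_; ∃; ∃₂)
open import Data.Sum using (_⊎_; inj₁; inj₂)
open import Data.Empty using (⊥; ⊥-elim)
open import Function using (_∘_)
open import Function.Definitions using (Injective)
open import Function.Bundles using (_⇔_; mk⇔)
open import Relation.Nullary using (¬_; yes; no)
open import Relation.Binary.PropositionalEquality
  using (_≡_; _≢_; refl; trans; cong; subst; subst₂; ≢-sym) renaming (sym to ≡-sym)

private
  variable
    n m i j k : ℕ

x∈p∧y∈p∧z∈p⇒3≤∣p∣ : ∀ (p : Subset n) {x y z} → x ∈ p → y ∈ p → z ∈ p →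
                    x ≢ y → x ≢ z → y ≢ z → 3 ≤ ∣ p ∣
x∈p∧y∈p∧z∈p⇒3≤∣p∣ p {x} {y} x∈p y∈p z∈p x≢y x≢z y≢z =
  ≤-trans (s≤s (≤-trans (s≤s (≤-trans (s≤s z≤n) (x∈p⇒∣p-x∣<∣p∣ z∈p-x-y)))
                        (x∈p⇒∣p-x∣<∣p∣ y∈p-x)))
          (x∈p⇒∣p-x∣<∣p∣ x∈p)
  where
  y∈p-x : y ∈ p - x
  y∈p-x = x∈p∧x≢y⇒x∈p-y y∈p (≢-sym x≢y)
  z∈p-x-y : _ ∈ (p - x) - y
  z∈p-x-y = x∈p∧x≢y⇒x∈p-y (x∈p∧x≢y⇒x∈p-y z∈p (≢-sym x≢z)) (≢-sym y≢z)

Adj-sym : ∀ (G : Graph n) {u v} → Adj G u v → Adj G v u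
Adj-sym G {u} {v} u~v = trans (Graph.sym G v u) u~v

Adj⇒∈neighbours : ∀ (G : Graph n) {v u} → Adj G v u → u ∈ tabulate (adj G v)
Adj⇒∈neighbours G {v} {u} v~u = lookup⇒[]= u _ (trans (lookup∘tabulate (adj G v) u) v~u)

degree≡2⇒neighbour : ∀ (G : Graph n) {v a b c} → degree G v ≡ 2 →
                     Adj G v a → Adj G v b → a ≢ b → Adj G v c → c ≡ a ⊎ c ≡ b
degree≡2⇒neighbour G {v} {a} {b} {c} deg≡2 v~a v~b a≢b v~c with c ≟ a | c ≟ b
... | yes c≡a | _       = inj₁ c≡a
... | no _    | yes c≡b = inj₂ c≡b
... | no c≢a  | no c≢b  = ⊥-elim (<⇒≱ ≤-refl (subst (3 ≤_) deg≡2 3≤degree))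
  where
  3≤degree : 3 ≤ degree G v
  3≤degree = x∈p∧y∈p∧z∈p⇒3≤∣p∣ (tabulate (adj G v))
    (Adj⇒∈neighbours G v~a) (Adj⇒∈neighbours G v~b) (Adj⇒∈neighbours G v~c)
    a≢b (≢-sym c≢a) (≢-sym c≢b)

-- z differs from y and y′ by irreflexivity, so x y z y′ is a genuine 4-cycle.
OnFourCycle : Graph n → Fin n → Set
OnFourCycle G x = ∃₂ λ y y′ → y ≢ y′ × Adj G x y × Adj G x y′ ×
                    ∃ λ z → z ≢ x × Adj G z y × Adj G z y′

another : (a : Fin (suc (suc m))) → ∃ λ b → b ≢ a
another zero    = suc zero , λ ()
another (suc a) = zero , λ ()

biclique⇒OnFourCycle : ∀ (G : Graph n) {f : Fin i → Fin n} {g : Fin j → Fin n} →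
                       2 ≤ i → 2 ≤ j → Injective _≡_ _≡_ f → Injective _≡_ _≡_ g →
                       (∀ a b → Adj G (f a) (g b)) → ∀ a → OnFourCycle G (f a)
biclique⇒OnFourCycle G {f} {g} (s≤s (s≤s _)) (s≤s (s≤s _)) f-inj g-inj f~g a
  with another a
... | a′ , a′≢a =
  g zero , g (suc zero) , (λ ()) ∘ g-inj , f~g a zero , f~g a (suc zero) ,
  f a′ , a′≢a ∘ f-inj , f~g a′ zero , f~g a′ (suc zero)

pathMiddle-¬OnFourCycle : ∀ (G : Graph n) {v₁ v₂ v₃ v₄ v₅} →
  v₁ ≢ v₃ → v₁ ≢ v₅ → v₂ ≢ v₄ → v₃ ≢ v₅ →
  Adj G v₁ v₂ → Adj G v₂ v₃ → Adj G v₃ v₄ → Adj G v₄ v₅ →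
  degree G v₂ ≡ 2 → degree G v₃ ≡ 2 → degree G v₄ ≡ 2 → ¬ OnFourCycle G v₃
pathMiddle-¬OnFourCycle G {v₁} {v₂} {v₃} {v₄} {v₅} v₁≢v₃ v₁≢v₅ v₂≢v₄ v₃≢v₅
  v₁~v₂ v₂~v₃ v₃~v₄ v₄~v₅ deg₂ deg₃ deg₄ (y , y′ , y≢y′ , v₃~y , v₃~y′ , z , z≢v₃ , z~y , z~y′)
  = absurd (neighbour-v₃ v₃~y) (neighbour-v₃ v₃~y′)
  where
  neighbour-v₃ : ∀ {w} → Adj G v₃ w → w ≡ v₂ ⊎ w ≡ v₄
  neighbour-v₃ = degree≡2⇒neighbour G deg₃ (Adj-sym G v₂~v₃) v₃~v₄ v₂≢v₄
  z≡v₁ : Adj G z v₂ → z ≡ v₁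
  z≡v₁ z~v₂ with degree≡2⇒neighbour G deg₂ (Adj-sym G v₁~v₂) v₂~v₃ v₁≢v₃ (Adj-sym G z~v₂)
  ... | inj₁ z≡v₁ = z≡v₁
  ... | inj₂ z≡v₃ = ⊥-elim (z≢v₃ z≡v₃)
  z≡v₅ : Adj G z v₄ → z ≡ v₅
  z≡v₅ z~v₄ with degree≡2⇒neighbour G deg₄ (Adj-sym G v₃~v₄) v₄~v₅ v₃≢v₅ (Adj-sym G z~v₄)
  ... | inj₁ z≡v₃ = ⊥-elim (z≢v₃ z≡v₃)
  ... | inj₂ z≡v₅ = z≡v₅
  absurd : y ≡ v₂ ⊎ y ≡ v₄ → y′ ≡ v₂ ⊎ y′ ≡ v₄ → ⊥
  absurd (inj₁ refl) (inj₁ refl) = y≢y′ refl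
  absurd (inj₂ refl) (inj₂ refl) = y≢y′ refl
  absurd (inj₁ refl) (inj₂ refl) = v₁≢v₅ (trans (≡-sym (z≡v₁ z~y)) (z≡v₅ z~y′))
  absurd (inj₂ refl) (inj₁ refl) = v₁≢v₅ (trans (≡-sym (z≡v₁ z~y′)) (z≡v₅ z~y))

lookup-removeAt : ∀ {A : Set} (xs : Vec A (suc n)) x u →
                  lookup (removeAt xs x) u ≡ lookup xs (punchIn x u)
lookup-removeAt (_ ∷ _)      zero    _       = refl
lookup-removeAt (_ ∷ _ ∷ _)  (suc x) zero    = refl
lookup-removeAt (_ ∷ y ∷ xs) (suc x) (suc u) = lookup-removeAt (y ∷ xs) x u

punchIn∈p⇒∈removeAt-p : ∀ {p : Subset (suc n)} {x u} → punchIn x u ∈ p → u ∈ removeAt p x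
punchIn∈p⇒∈removeAt-p {p = p} {x} {u} ∈p =
  lookup⇒[]= u _ (trans (lookup-removeAt p x u) ([]=⇒lookup ∈p))

u∈p⇒punchIn∈insertAt-p : ∀ {p : Subset n} {x u} b → u ∈ p → punchIn x u ∈ insertAt p x b
u∈p⇒punchIn∈insertAt-p {p = p} {x} {u} b ∈p =
  lookup⇒[]= (punchIn x u) _ (trans (insertAt-punchIn p x b u) ([]=⇒lookup ∈p))

∣removeAt-p∣≤∣p∣ : ∀ (p : Subset (suc n)) x → ∣ removeAt p x ∣ ≤ ∣ p ∣
∣removeAt-p∣≤∣p∣ (inside  ∷ _)     zero    = m≤n⇒m≤1+n ≤-refl
∣removeAt-p∣≤∣p∣ (outside ∷ _)     zero    = ≤-refl
∣removeAt-p∣≤∣p∣ (inside  ∷ b ∷ p) (suc x) = s≤s (∣removeAt-p∣≤∣p∣ (b ∷ p) x)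
∣removeAt-p∣≤∣p∣ (outside ∷ b ∷ p) (suc x) = ∣removeAt-p∣≤∣p∣ (b ∷ p) x

∣insertAt-p-outside∣≡∣p∣ : ∀ (p : Subset n) x → ∣ insertAt p x outside ∣ ≡ ∣ p ∣
∣insertAt-p-outside∣≡∣p∣ p             zero    = refl
∣insertAt-p-outside∣≡∣p∣ (inside  ∷ p) (suc x) = cong suc (∣insertAt-p-outside∣≡∣p∣ p x)
∣insertAt-p-outside∣≡∣p∣ (outside ∷ p) (suc x) = ∣insertAt-p-outside∣≡∣p∣ p x

biclique-lift : ∀ (G : Graph (suc n)) {x S} →
                ContainsBicliqueAvoiding (deleteVertex G x) (removeAt S x) i j →
                ContainsBicliqueAvoiding G S i j
biclique-lift G {x} (f , g , f-inj , g-inj , f≢g , f∉S , g∉S , f~g) =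
  punchIn x ∘ f , punchIn x ∘ g ,
  f-inj ∘ punchIn-injective x _ _ , g-inj ∘ punchIn-injective x _ _ ,
  (λ a b → f≢g a b ∘ punchIn-injective x _ _) ,
  (λ a → f∉S a ∘ punchIn∈p⇒∈removeAt-p) , (λ b → g∉S b ∘ punchIn∈p⇒∈removeAt-p) ,
  f~g

biclique-restrict : ∀ (G : Graph (suc n)) {x S} → ¬ OnFourCycle G x → 2 ≤ i → 2 ≤ j →
                    ContainsBicliqueAvoiding G (insertAt S x outside) i j →
                    ContainsBicliqueAvoiding (deleteVertex G x) S i j
biclique-restrict G {x} {S} x∉C₄ 2≤i 2≤j (f , g , f-inj , g-inj , f≢g , f∉S , g∉S , f~g) =
  f′ , g′ ,
  (λ e → f-inj (subst₂ _≡_ (f′-eq _) (f′-eq _) (cong (punchIn x) e))) ,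
  (λ e → g-inj (subst₂ _≡_ (g′-eq _) (g′-eq _) (cong (punchIn x) e))) ,
  (λ a b e → f≢g a b (subst₂ _≡_ (f′-eq a) (g′-eq b) (cong (punchIn x) e))) ,
  (λ a → f∉S a ∘ subst (_∈ _) (f′-eq a) ∘ u∈p⇒punchIn∈insertAt-p outside) ,
  (λ b → g∉S b ∘ subst (_∈ _) (g′-eq b) ∘ u∈p⇒punchIn∈insertAt-p outside) ,
  (λ a b → subst₂ (Adj G) (≡-sym (f′-eq a)) (≡-sym (g′-eq b)) (f~g a b))
  where
  x≢f : ∀ a → x ≢ f a
  x≢f a x≡fa = x∉C₄ (subst (OnFourCycle G) (≡-sym x≡fa)
    (biclique⇒OnFourCycle G 2≤i 2≤j f-inj g-inj f~g a))
  x≢g : ∀ b → x ≢ g b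
  x≢g b x≡gb = x∉C₄ (subst (OnFourCycle G) (≡-sym x≡gb)
    (biclique⇒OnFourCycle G 2≤j 2≤i g-inj f-inj (λ b a → Adj-sym G (f~g a b)) b))
  f′ = λ a → punchOut (x≢f a)
  g′ = λ b → punchOut (x≢g b)
  f′-eq : ∀ a → punchIn x (f′ a) ≡ f a
  f′-eq a = punchIn-punchOut (x≢f a)
  g′-eq : ∀ b → punchIn x (g′ b) ≡ g b
  g′-eq b = punchIn-punchOut (x≢g b)

YesInstance⇔deleteVertex : ∀ (G : Graph (suc n)) {x} → ¬ OnFourCycle G x → 2 ≤ i → 2 ≤ j →
                           YesInstance G k i j ⇔ YesInstance (deleteVertex G x) k i j
YesInstance⇔deleteVertex {k = k} G {x} x∉C₄ 2≤i 2≤j = mk⇔ delete undelete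
  where
  delete : YesInstance G _ _ _ → YesInstance (deleteVertex G x) _ _ _
  delete (S , ∣S∣≤k , S-hits) =
    removeAt S x , ≤-trans (∣removeAt-p∣≤∣p∣ S x) ∣S∣≤k , S-hits ∘ biclique-lift G
  undelete : YesInstance (deleteVertex G x) _ _ _ → YesInstance G _ _ _
  undelete (S , ∣S∣≤k , S-hits) =
    insertAt S x outside , subst (_≤ k) (≡-sym (∣insertAt-p-outside∣≡∣p∣ S x)) ∣S∣≤k ,
    S-hits ∘ biclique-restrict G x∉C₄ 2≤i 2≤j

lemma24 : (n : ℕ) (G : Graph (suc n)) (k i j : ℕ) → 2 ≤ i → i ≤ j →
          (v₁ v₂ v₃ v₄ v₅ : Fin (suc n)) →
          v₁ ≢ v₂ → v₁ ≢ v₃ → v₁ ≢ v₄ → v₁ ≢ v₅ → v₂ ≢ v₃ →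
          v₂ ≢ v₄ → v₂ ≢ v₅ → v₃ ≢ v₄ → v₃ ≢ v₅ → v₄ ≢ v₅ →
          Adj G v₁ v₂ → Adj G v₂ v₃ → Adj G v₃ v₄ → Adj G v₄ v₅ →
          degree G v₂ ≡ 2 → degree G v₃ ≡ 2 → degree G v₄ ≡ 2 →
          YesInstance G k i j ⇔ YesInstance (deleteVertex G v₃) k i j
lemma24 n G k i j 2≤i i≤j v₁ v₂ v₃ v₄ v₅ _ v₁≢v₃ _ v₁≢v₅ _ v₂≢v₄ _ _ v₃≢v₅ _
        v₁~v₂ v₂~v₃ v₃~v₄ v₄~v₅ deg₂ deg₃ deg₄ =
  YesInstance⇔deleteVertex G
    (pathMiddle-¬OnFourCycle G v₁≢v₃ v₁≢v₅ v₂≢v₄ v₃≢v₅ v₁~v₂ v₂~v₃ v₃~v₄ v₄~v₅ deg₂ deg₃ deg₄)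
    2≤i (≤-trans 2≤i i≤j)
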